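{- Let $D=(V,A)$ be a loopless, weakly connected digraph with at least two nodes, and let $\{F,R,N\}$ be a partition of $A$. The following are equivalent: (A) $D$ admits a dicut-equivalent reorientation in which every arc of $R$ is reversed while the orientation of every arc of $F$ is unchanged; (B) there is a small-dropping potential $\pi$ with $\Delta_\pi(e)=1$ for all $e\in R$ and $\Delta_\pi(e)=0$ for all $e\in F$; (C) for every circuit $C$ of $D$ and each of the two directions of traversing $C$, the number of $R$-arcs of $C$ oriented in that direction is at most the number of $(R\cup N)$-arcs of $C$ oriented in the other direction.
   Context: A dicut of $D$ is the set of arcs connecting $Z$ and $V\setminus Z$ for some $Z\subseteq V$ such that no arc of $D$ enters $Z$. A dicut-equivalent reorientation of $D$ arises from $D$ by reversing every arc of some pairwise disjoint dicuts of $D$. For $\pi:V\to\mathbb{R}$, $\Delta_\pi(uv)=\pi(v)-\pi(u)$; $\pi$ is small-dropping if it is integer-valued and $\Delta_\pi(e)\in\{0,1\}$ for every $e\in A$. A circuit of $D$ is a subgraph whose underlying undirected graph is a cycle (arcs arbitrarily oriented). -}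

module Defs where

open import Data.Nat using (ℕ; zero; suc; _+_; _≤_)
open import Data.Fin using (Fin; inject₁; suc; zero)
open import Data.Fin.Subset using (Subset; _∈_; _∉_)
open import Data.Integer using (ℤ; _-_; 0ℤ; 1ℤ)
open import Data.Product using (Σ; _×_; ∃; _,_)
open import Data.Sum using (_⊎_)
open import Data.Empty using (⊥)
open import Relation.Nullary using (¬_; yes; no)
open import Relation.Nullary.Decidable using (⌊_⌋)
open import Data.Bool using (Bool; true; false; if_then_else_; _∧_)
open import Relation.Binary.PropositionalEquality using (_≡_; _≢_)
open import Function.Definitions using (Injective)
import Data.Fin as F

record Digraph : Set where
  field
    n    : ℕ
    m    : ℕ
    tail : Fin m → Fin n
    head : Fin m → Fin n
open Digraph public

Loopless : Digraph → Set
Loopless D = ∀ e → tail D e ≢ head D e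

data UWalk (D : Digraph) : Fin (n D) → Fin (n D) → Set where
  here : ∀ {u} → UWalk D u u
  fwd  : ∀ {v} (e : Fin (m D)) → UWalk D (head D e) v → UWalk D (tail D e) v
  bwd  : ∀ {v} (e : Fin (m D)) → UWalk D (tail D e) v → UWalk D (head D e) v

WeaklyConnected : Digraph → Set
WeaklyConnected D = ∀ u v → UWalk D u v

-- the partition {F,R,N} of A, given by a labelling of arcs
data Part : Set where
  F R N : Part

NoArcEnters : (D : Digraph) → Subset (n D) → Set
NoArcEnters D Z = ∀ e → ¬ (head D e ∈ Z × tail D e ∉ Z)

InCut : (D : Digraph) → Subset (n D) → Fin (m D) → Set
InCut D Z e = (tail D e ∈ Z × head D e ∉ Z) ⊎ (head D e ∈ Z × tail D e ∉ Z)

record DisjointDicuts (D : Digraph) : Set where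
  field
    p        : ℕ
    Z        : Fin p → Subset (n D)
    dicut    : ∀ i → NoArcEnters D (Z i)
    disjoint : ∀ i j e → i ≢ j → InCut D (Z i) e → InCut D (Z j) e → ⊥
open DisjointDicuts public

-- arc e is reversed in the dicut-equivalent reorientation obtained from 𝒵
Reversed : (D : Digraph) → DisjointDicuts D → Fin (m D) → Set
Reversed D 𝒵 e = ∃ λ i → InCut D (Z 𝒵 i) e

Δ : (D : Digraph) → (Fin (n D) → ℤ) → Fin (m D) → ℤ
Δ D π e = π (head D e) - π (tail D e)

SmallDropping : (D : Digraph) → (Fin (n D) → ℤ) → Set
SmallDropping D π = ∀ e → Δ D π e ≡ 0ℤ ⊎ Δ D π e ≡ 1ℤ

-- A circuit, given together with a traversal: distinct nodes v 0 … v (k-1)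
-- (v k = v 0), distinct arcs a 0 … a (k-1), arc a i joins v i and v (i+1)
-- in some orientation, k ≥ 2.
record Circuit (D : Digraph) : Set where
  field
    k      : ℕ
    k≥2    : 2 ≤ k
    v      : Fin (suc k) → Fin (n D)
    closed : v (F.fromℕ k) ≡ v zero
    v-inj  : Injective _≡_ _≡_ (λ (i : Fin k) → v (inject₁ i))
    a      : Fin k → Fin (m D)
    a-inj  : Injective _≡_ _≡_ a
    joins  : ∀ i → (tail D (a i) ≡ v (inject₁ i) × head D (a i) ≡ v (suc i))
                 ⊎ (head D (a i) ≡ v (inject₁ i) × tail D (a i) ≡ v (suc i))
open Circuit public

count : ∀ {k} → (Fin k → Bool) → ℕ
count {zero}  P = 0
count {suc k} P = (if P zero then 1 else 0) + count (λ i → P (suc i))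

forward : (D : Digraph) (C : Circuit D) → Fin (k C) → Bool
forward D C i = ⌊ tail D (a C i) F.≟ v C (inject₁ i) ⌋

backward : (D : Digraph) (C : Circuit D) → Fin (k C) → Bool
backward D C i = ⌊ head D (a C i) F.≟ v C (inject₁ i) ⌋

isR : Part → Bool
isR R = true
isR _ = false

isRN : Part → Bool
isRN F = false
isRN _ = true

{-# OPTIONS --safe #-}
module Submission where

-- Let a step traverse an arc e forwards at cost [e ∈ R ∪ N] or backwards at cost −[e ∈ R].
-- Then (B) says exactly that π(y) − π(x) ≤ cost(s) for every step s from x to y, and (C)
-- says exactly that every circuit, traversed in either direction, has nonnegative cost.
-- (A) ⇒ (B): let π(v) count the shores Z_i not containing v; by disjointness Δ_π(e) is the
-- number of dicuts containing e.  (B) ⇒ (A): after shifting π to be nonnegative, its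
-- sublevel sets {v : π(v) ≤ i} are disjoint dicuts, cutting exactly the arcs with Δ_π = 1.
-- (B) ⇒ (C): potential differences telescope to 0 around a circuit.  (C) ⇒ (B): a closed
-- walk splits at a repeated vertex into shorter closed walks, down to circuits and arcs
-- traversed back and forth, so no closed walk has negative cost; hence the Bellman–Ford
-- distances d over walks of length at most |V| are stable, and π = −d works.

open import Defs

open import Data.Bool using (Bool; true; false; _∧_; not)
open import Data.Bool.Properties using (not-involutive)
open import Data.Empty using (⊥; ⊥-elim)
open import Data.Fin using (Fin; inject₁; toℕ; fromℕ)
import Data.Fin as F
import Data.Fin.Properties as Fₚ
open import Data.Fin.Subset using (Subset) renaming (_∈_ to _∈ₛ_; _∉_ to _∉ₛ_)
open import Data.Fin.Subset.Properties using (_∈?_)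
open import Data.Integer using (ℤ; +_; 0ℤ; 1ℤ; +≤+; -≤+)
import Data.Integer as ℤ
import Data.Integer.Properties as ℤₚ
open import Data.Integer.Tactic.RingSolver using (solve-∀)
open import Data.List using (List; []; _∷_; map; allFin; filter; cartesianProduct)
open import Data.List.Membership.Propositional using (_∈_)
open import Data.List.Membership.Propositional.Properties
  using (∈-map⁺; ∈-map⁻; ∈-allFin; ∈-filter⁺; ∈-filter⁻; ∈-cartesianProduct⁺)
import Data.List.Relation.Unary.All as All
open import Data.List.Relation.Unary.Any using (here; there)
open import Data.Nat using (ℕ; zero; suc; _+_; _≤_; _<_; _≤?_; z≤n; s≤s; _∸_)
open import Data.Nat.Induction using (<-rec)
import Data.Nat.Properties as ℕₚ
open import Data.Product using (_×_; ∃; ∃₂; _,_; proj₁; proj₂)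
import Data.Product as Product
open import Data.Sum using (_⊎_; inj₁; inj₂)
import Data.Sum as Sum
open import Data.Vec using (tabulate)
import Data.Vec.Properties as Vecₚ
open import Function using (_∘_; const; id)
open import Function.Bundles using (_⇔_; mk⇔; Equivalence)
open import Function.Definitions using (Injective)
open import Relation.Binary.Definitions using (DecidableEquality; tri<; tri≈; tri>)
open import Relation.Binary.PropositionalEquality
open import Relation.Nullary using (¬_; Dec; yes; no)
open import Relation.Nullary.Decidable
  using (⌊_⌋; isYes≗does; dec-true; dec-false; _×-dec_; _⊎-dec_; ¬?)

open import Algebra.Properties.CommutativeMonoid.Sum ℤₚ.+-0-commutativeMonoid
  using (sum; sum-syntax; sum-cong-≗; sum-replicate-zero; sum-remove; ∑-distrib-+)
import Data.List.Extrema ℤₚ.≤-totalOrder as ℤ-Extrema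
import Data.List.Extrema ℕₚ.≤-totalOrder as ℕ-Extrema

indicator : Bool → ℤ
indicator true  = 1ℤ
indicator false = 0ℤ

∑-neg : ∀ {k} (f : Fin k → ℤ) → ∑[ i < k ] (ℤ.- f i) ≡ ℤ.- sum f
∑-neg {zero}  f = refl
∑-neg {suc k} f =
  trans (cong (ℤ._+_ (ℤ.- f F.zero)) (∑-neg (f ∘ F.suc))) (sym (ℤₚ.neg-distrib-+ (f F.zero) _))

∑-distrib-- : ∀ {k} (f g : Fin k → ℤ) → ∑[ i < k ] (f i ℤ.- g i) ≡ sum f ℤ.- sum g
∑-distrib-- f g = trans (∑-distrib-+ f (ℤ.-_ ∘ g)) (cong (ℤ._+_ (sum f)) (∑-neg g))

∑-mono-≤ : ∀ {k} {f g : Fin k → ℤ} → (∀ i → f i ℤ.≤ g i) → sum f ℤ.≤ sum g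
∑-mono-≤ {zero}  f≤g = ℤₚ.≤-refl
∑-mono-≤ {suc k} f≤g = ℤₚ.+-mono-≤ (f≤g F.zero) (∑-mono-≤ (f≤g ∘ F.suc))

∑-zero : ∀ {k} {f : Fin k → ℤ} → (∀ i → f i ≡ 0ℤ) → sum f ≡ 0ℤ
∑-zero {k} f≡0 = trans (sum-cong-≗ f≡0) (sum-replicate-zero k)

∑-single : ∀ {k} (f : Fin k → ℤ) i → (∀ j → j ≢ i → f j ≡ 0ℤ) → sum f ≡ f i
∑-single {suc k} f i others = begin
  sum f                          ≡⟨ sum-remove {i = i} f ⟩
  f i ℤ.+ sum (f ∘ F.punchIn i)  ≡⟨ cong (ℤ._+_ (f i)) (∑-zero (λ j → others _ (Fₚ.punchInᵢ≢i i j))) ⟩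
  f i ℤ.+ 0ℤ                     ≡⟨ ℤₚ.+-identityʳ (f i) ⟩
  f i                            ∎
  where open ≡-Reasoning

∑-telescope : ∀ k (g : Fin (suc k) → ℤ) →
  ∑[ i < k ] (g (F.suc i) ℤ.- g (inject₁ i)) ≡ g (fromℕ k) ℤ.- g F.zero
∑-telescope zero    g = sym (ℤₚ.+-inverseʳ (g F.zero))
∑-telescope (suc k) g = begin
  (g₁ ℤ.- g₀) ℤ.+ ∑[ i < k ] (g (F.suc (F.suc i)) ℤ.- g (F.suc (inject₁ i)))
    ≡⟨ cong (ℤ._+_ (g₁ ℤ.- g₀)) (∑-telescope k (g ∘ F.suc)) ⟩
  (g₁ ℤ.- g₀) ℤ.+ (g (fromℕ (suc k)) ℤ.- g₁)
    ≡⟨ ℤₚ.+-comm (g₁ ℤ.- g₀) _ ⟩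
  (g (fromℕ (suc k)) ℤ.- g₁) ℤ.+ (g₁ ℤ.- g₀)
    ≡⟨ ℤₚ.+-minus-telescope (g (fromℕ (suc k))) g₁ g₀ ⟩
  g (fromℕ (suc k)) ℤ.- g₀ ∎
  where
  open ≡-Reasoning
  g₀ g₁ : ℤ
  g₀ = g F.zero
  g₁ = g (F.suc F.zero)

count-as-sum : ∀ {k} (p : Fin k → Bool) → + count p ≡ ∑[ i < k ] indicator (p i)
count-as-sum {zero}  p = refl
count-as-sum {suc k} p with p F.zero
... | true  = cong (ℤ._+_ 1ℤ) (count-as-sum (p ∘ F.suc))
... | false = cong (ℤ._+_ 0ℤ) (count-as-sum (p ∘ F.suc))

∑-indicator-difference : ∀ {k} (p q : Fin k → Bool) →
  ∑[ i < k ] (indicator (p i) ℤ.- indicator (q i)) ≡ + count p ℤ.- + count q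
∑-indicator-difference p q =
  trans (∑-distrib-- (indicator ∘ p) (indicator ∘ q))
        (sym (cong₂ ℤ._-_ (count-as-sum p) (count-as-sum q)))

neg-minus : ∀ x y → ℤ.- (x ℤ.- y) ≡ y ℤ.- x
neg-minus = solve-∀

neg-minus-neg : ∀ x y → ℤ.- x ℤ.- ℤ.- y ≡ y ℤ.- x
neg-minus-neg = solve-∀

i≤j+k⇒i-k≤j : ∀ {i j k} → i ℤ.≤ j ℤ.+ k → i ℤ.- k ℤ.≤ j
i≤j+k⇒i-k≤j {i} {j} {k} i≤j+k =
  subst (i ℤ.- k ℤ.≤_) (cancel j k) (ℤₚ.+-monoˡ-≤ (ℤ.- k) i≤j+k)
  where
  cancel : ∀ x y → x ℤ.+ y ℤ.- y ≡ x
  cancel = solve-∀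

0≤-difference⇒≤ : ∀ {a b} → 0ℤ ℤ.≤ + a ℤ.- + b → b ≤ a
0≤-difference⇒≤ = ℤₚ.drop‿+≤+ ∘ ℤₚ.0≤i-j⇒j≤i

≤⇒0≤-difference : ∀ {a b} → b ≤ a → 0ℤ ℤ.≤ + a ℤ.- + b
≤⇒0≤-difference = ℤₚ.i≤j⇒0≤j-i ∘ +≤+

difference≡0 : ∀ {a b} → + a ℤ.- + b ≡ 0ℤ → a ≡ b
difference≡0 = ℤₚ.+-injective ∘ ℤₚ.i-j≡0⇒i≡j _ _

difference≡1 : ∀ {a b} → + a ℤ.- + b ≡ 1ℤ → a ≡ suc b
difference≡1 {a} {b} a-b≡1 = ℤₚ.+-injective (begin
  + a                       ≡⟨ minus-plus (+ a) (+ b) ⟩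
  (+ a ℤ.- + b) ℤ.+ + b     ≡⟨ cong (λ x → x ℤ.+ + b) a-b≡1 ⟩
  + suc b                   ∎)
  where
  open ≡-Reasoning
  minus-plus : ∀ x y → x ≡ (x ℤ.- y) ℤ.+ y
  minus-plus = solve-∀

0≤x≤1 : ∀ {x} → 0ℤ ℤ.≤ x → x ℤ.≤ 1ℤ → x ≡ 0ℤ ⊎ x ≡ 1ℤ
0≤x≤1 {+ zero}          _ _                 = inj₁ refl
0≤x≤1 {+ suc zero}      _ _                 = inj₂ refl
0≤x≤1 {+ suc (suc _)}   _ (+≤+ (s≤s ()))

shift-to-ℕ : ∀ {k} (π : Fin k → ℤ) → ∃ λ (σ : Fin k → ℕ) → ∀ u v → π u ℤ.- π v ≡ + σ u ℤ.- + σ v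
shift-to-ℕ {k} π = σ , λ u v → begin
  π u ℤ.- π v                     ≡⟨ cancel (π u) (π v) c ⟩
  (π u ℤ.- c) ℤ.- (π v ℤ.- c)     ≡⟨ sym (cong₂ ℤ._-_ (+σ≡ u) (+σ≡ v)) ⟩
  + σ u ℤ.- + σ v                 ∎
  where
  open ≡-Reasoning
  c : ℤ
  c = ℤ-Extrema.min 0ℤ (map π (allFin k))
  σ : Fin k → ℕ
  σ u = ℤ.∣ π u ℤ.- c ∣
  +σ≡ : ∀ u → + σ u ≡ π u ℤ.- c
  +σ≡ u = ℤₚ.0≤i⇒+∣i∣≡i (ℤₚ.i≤j⇒0≤j-i
    (All.lookup (ℤ-Extrema.min≤xs 0ℤ (map π (allFin k))) (∈-map⁺ π (∈-allFin u))))
  cancel : ∀ x y z → x ℤ.- y ≡ (x ℤ.- z) ℤ.- (y ℤ.- z)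
  cancel = solve-∀

⌊⌋-true : ∀ {P : Set} (P? : Dec P) → P → ⌊ P? ⌋ ≡ true
⌊⌋-true P? p = trans (isYes≗does P?) (dec-true P? p)

⌊⌋-false : ∀ {P : Set} (P? : Dec P) → ¬ P → ⌊ P? ⌋ ≡ false
⌊⌋-false P? ¬p = trans (isYes≗does P?) (dec-false P? ¬p)

∈-tabulate⇔ : ∀ {k} {P : Fin k → Set} (P? : ∀ u → Dec (P u)) u →
  u ∈ₛ tabulate (λ x → ⌊ P? x ⌋) ⇔ P u
∈-tabulate⇔ P? u = mk⇔
  (λ u∈ → witness (P? u) (trans (sym (Vecₚ.lookup∘tabulate _ u)) (Vecₚ.[]=⇒lookup u∈)))
  (λ pu → Vecₚ.lookup⇒[]= u _ (trans (Vecₚ.lookup∘tabulate _ u) (⌊⌋-true (P? u) pu)))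
  where
  witness : ∀ {Q : Set} (Q? : Dec Q) → ⌊ Q? ⌋ ≡ true → Q
  witness (yes q) _ = q

injective₂ : ∀ {A : Set} {f : Fin 2 → A} → f F.zero ≢ f (F.suc F.zero) → Injective _≡_ _≡_ f
injective₂ _     {F.zero}       {F.zero}       _    = refl
injective₂ f₀≢f₁ {F.zero}       {F.suc F.zero} same = ⊥-elim (f₀≢f₁ same)
injective₂ f₀≢f₁ {F.suc F.zero} {F.zero}       same = ⊥-elim (f₀≢f₁ (sym same))
injective₂ _     {F.suc F.zero} {F.suc F.zero} _    = refl

Repeats : ∀ {k} {A : Set} → (Fin k → A) → Set
Repeats f = ∃₂ λ i j → i F.< j × f i ≡ f j

repeats? : ∀ {k} {A : Set} → DecidableEquality A → (f : Fin k → A) → Dec (Repeats f)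
repeats? _≟_ f = Fₚ.any? λ i → Fₚ.any? λ j → (i F.<? j) ×-dec (f i ≟ f j)

¬repeats⇒injective : ∀ {k} {A : Set} {f : Fin k → A} → ¬ Repeats f → Injective _≡_ _≡_ f
¬repeats⇒injective no-repeat {i} {j} fi≡fj with Fₚ.<-cmp i j
... | tri< i<j _ _ = ⊥-elim (no-repeat (i , j , i<j , fi≡fj))
... | tri≈ _ i≡j _ = i≡j
... | tri> _ _ j<i = ⊥-elim (no-repeat (j , i , j<i , sym fi≡fj))

cost : Part → Bool → ℤ
cost ℓ b = indicator (b ∧ isRN ℓ) ℤ.- indicator (not b ∧ isR ℓ)

cost-backtrack : ∀ ℓ b → 0ℤ ℤ.≤ cost ℓ b ℤ.+ cost ℓ (not b)
cost-backtrack F true  = +≤+ z≤n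
cost-backtrack F false = +≤+ z≤n
cost-backtrack R true  = +≤+ z≤n
cost-backtrack R false = +≤+ z≤n
cost-backtrack N true  = +≤+ z≤n
cost-backtrack N false = +≤+ z≤n

FitsLabel : Part → ℤ → Set
FitsLabel ℓ x = (x ≡ 0ℤ ⊎ x ≡ 1ℤ) × (ℓ ≡ R → x ≡ 1ℤ) × (ℓ ≡ F → x ≡ 0ℤ)

fits⇒cost-bounds : ∀ ℓ {x} → FitsLabel ℓ x → x ℤ.≤ cost ℓ true × ℤ.- x ℤ.≤ cost ℓ false
fits⇒cost-bounds R (_ , x≡1 , _) rewrite x≡1 refl = ℤₚ.≤-refl , ℤₚ.≤-refl
fits⇒cost-bounds F (_ , _ , x≡0) rewrite x≡0 refl = ℤₚ.≤-refl , ℤₚ.≤-refl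
fits⇒cost-bounds N (inj₁ refl , _) = +≤+ z≤n , ℤₚ.≤-refl
fits⇒cost-bounds N (inj₂ refl , _) = ℤₚ.≤-refl , -≤+

cost-bounds⇒fits : ∀ ℓ {x} → x ℤ.≤ cost ℓ true → ℤ.- x ℤ.≤ cost ℓ false → FitsLabel ℓ x
cost-bounds⇒fits R {x} x≤1 -x≤-1 = inj₂ x≡1 , const x≡1 , λ ()
  where
  x≡1 : x ≡ 1ℤ
  x≡1 = ℤₚ.≤-antisym x≤1 (ℤₚ.neg-cancel-≤ {j = 1ℤ} -x≤-1)
cost-bounds⇒fits F {x} x≤0 -x≤0 = inj₁ x≡0 , (λ ()) , const x≡0
  where
  x≡0 : x ≡ 0ℤ
  x≡0 = ℤₚ.≤-antisym x≤0 (ℤₚ.neg-cancel-≤ {j = 0ℤ} -x≤0)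
cost-bounds⇒fits N x≤1 -x≤0 = 0≤x≤1 (ℤₚ.neg-cancel-≤ {j = 0ℤ} -x≤0) x≤1 , (λ ()) , (λ ())

module _ (D : Digraph) where

  Step : Set
  Step = Fin (m D) × Bool

  src tgt : Step → Fin (n D)
  src (e , true)  = tail D e
  src (e , false) = head D e
  tgt (e , b) = src (e , not b)

  reverse : Step → Step
  reverse (e , b) = e , not b

  tgt-reverse : ∀ s → tgt (reverse s) ≡ src s
  tgt-reverse (e , true)  = refl
  tgt-reverse (e , false) = refl

  same-arc : ∀ s s′ → proj₁ s ≡ proj₁ s′ → s′ ≡ s ⊎ s′ ≡ reverse s
  same-arc (e , true)  (.e , true)  refl = inj₁ refl
  same-arc (e , true)  (.e , false) refl = inj₂ refl
  same-arc (e , false) (.e , true)  refl = inj₂ refl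
  same-arc (e , false) (.e , false) refl = inj₁ refl

  step-joins : ∀ s {x y} → src s ≡ x → tgt s ≡ y →
    (tail D (proj₁ s) ≡ x × head D (proj₁ s) ≡ y) ⊎ (head D (proj₁ s) ≡ x × tail D (proj₁ s) ≡ y)
  step-joins (e , true)  src≡ tgt≡ = inj₁ (src≡ , tgt≡)
  step-joins (e , false) src≡ tgt≡ = inj₂ (src≡ , tgt≡)

  Feasible : (Step → ℤ) → (Fin (n D) → ℤ) → Set
  Feasible w π = ∀ s → π (tgt s) ℤ.- π (src s) ℤ.≤ w s

  feasible-reverse : ∀ {w π} → Feasible w π → Feasible (w ∘ reverse) (ℤ.-_ ∘ π)
  feasible-reverse {π = π} feasible (e , true)  =
    subst (ℤ._≤ _) (sym (neg-minus-neg (π (head D e)) (π (tail D e)))) (feasible (e , false))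
  feasible-reverse {π = π} feasible (e , false) =
    subst (ℤ._≤ _) (sym (neg-minus-neg (π (tail D e)) (π (head D e)))) (feasible (e , true))

  module _ (lab : Fin (m D) → Part) where

    arcCost : Step → ℤ
    arcCost (e , b) = cost (lab e) b

    IsLabelReorientation : DisjointDicuts D → Set
    IsLabelReorientation 𝒵 =
      (∀ e → lab e ≡ R → Reversed D 𝒵 e) × (∀ e → lab e ≡ F → ¬ Reversed D 𝒵 e)

    CircuitCondition : Set
    CircuitCondition = ∀ (C : Circuit D) →
        (count (λ i → forward D C i ∧ isR (lab (a C i)))
           ≤ count (λ i → backward D C i ∧ isRN (lab (a C i))))
      × (count (λ i → backward D C i ∧ isR (lab (a C i)))
           ≤ count (λ i → forward D C i ∧ isRN (lab (a C i))))

    IsLabelPotential : (Fin (n D) → ℤ) → Set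
    IsLabelPotential π = SmallDropping D π ×
      (∀ e → lab e ≡ R → Δ D π e ≡ 1ℤ) × (∀ e → lab e ≡ F → Δ D π e ≡ 0ℤ)

    label-potential⇔feasible : ∀ π → IsLabelPotential π ⇔ Feasible arcCost π
    label-potential⇔feasible π = mk⇔ to from
      where
      to : IsLabelPotential π → Feasible arcCost π
      to (small , onR , onF) (e , true)  =
        proj₁ (fits⇒cost-bounds (lab e) (small e , onR e , onF e))
      to (small , onR , onF) (e , false) =
        subst (ℤ._≤ cost (lab e) false) (neg-minus (π (head D e)) (π (tail D e)))
        (proj₂ (fits⇒cost-bounds (lab e) (small e , onR e , onF e)))

      from : Feasible arcCost π → IsLabelPotential π
      from feasible = proj₁ ∘ fits , proj₁ ∘ proj₂ ∘ fits , proj₂ ∘ proj₂ ∘ fits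
        where
        fits : ∀ e → FitsLabel (lab e) (Δ D π e)
        fits e = cost-bounds⇒fits (lab e) (feasible (e , true))
          (subst (ℤ._≤ cost (lab e) false) (sym (neg-minus (π (head D e)) (π (tail D e))))
                 (feasible (e , false)))

  -- Depth potentials and sublevel dicuts

  inCut? : ∀ Z e → Dec (InCut D Z e)
  inCut? Z e = (tail D e ∈? Z ×-dec ¬? (head D e ∈? Z))
         ⊎-dec (head D e ∈? Z ×-dec ¬? (tail D e ∈? Z))

  module _ (𝒵 : DisjointDicuts D) where

    outside : Fin (n D) → Fin (p 𝒵) → ℤ
    outside u i = indicator (not ⌊ u ∈? Z 𝒵 i ⌋)

    depth : Fin (n D) → ℤ
    depth u = ∑[ i < p 𝒵 ] outside u i

    crossing : Fin (m D) → Fin (p 𝒵) → ℤ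
    crossing e i = outside (head D e) i ℤ.- outside (tail D e) i

    crossing-cut : ∀ e i → InCut D (Z 𝒵 i) e → crossing e i ≡ 1ℤ
    crossing-cut e i (inj₂ entering) = ⊥-elim (dicut 𝒵 i e entering)
    crossing-cut e i (inj₁ (t∈ , h∉)) with head D e ∈? Z 𝒵 i | tail D e ∈? Z 𝒵 i
    ... | yes h∈ | _     = ⊥-elim (h∉ h∈)
    ... | no _   | yes _ = refl
    ... | no _   | no t∉ = ⊥-elim (t∉ t∈)

    crossing-uncut : ∀ e i → ¬ InCut D (Z 𝒵 i) e → crossing e i ≡ 0ℤ
    crossing-uncut e i uncut with head D e ∈? Z 𝒵 i | tail D e ∈? Z 𝒵 i
    ... | yes _  | yes _  = refl
    ... | yes h∈ | no t∉  = ⊥-elim (dicut 𝒵 i e (h∈ , t∉))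
    ... | no h∉  | yes t∈ = ⊥-elim (uncut (inj₁ (t∈ , h∉)))
    ... | no _   | no _   = refl

    Δ-depth : ∀ e → Δ D depth e ≡ ∑[ i < p 𝒵 ] crossing e i
    Δ-depth e = sym (∑-distrib-- (outside (head D e)) (outside (tail D e)))

    Δ-depth-reversed : ∀ e → Reversed D 𝒵 e → Δ D depth e ≡ 1ℤ
    Δ-depth-reversed e (i , cut) =
      trans (Δ-depth e) (trans (∑-single (crossing e) i others) (crossing-cut e i cut))
      where
      others : ∀ j → j ≢ i → crossing e j ≡ 0ℤ
      others j j≢i = crossing-uncut e j (λ cutⱼ → disjoint 𝒵 j i e j≢i cutⱼ cut)

    Δ-depth-unreversed : ∀ e → ¬ Reversed D 𝒵 e → Δ D depth e ≡ 0ℤ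
    Δ-depth-unreversed e unreversed =
      trans (Δ-depth e) (∑-zero (λ j → crossing-uncut e j (λ cutⱼ → unreversed (j , cutⱼ))))

    depth-small-dropping : SmallDropping D depth
    depth-small-dropping e with Fₚ.any? (λ i → inCut? (Z 𝒵 i) e)
    ... | yes reversed   = inj₂ (Δ-depth-reversed e reversed)
    ... | no unreversed  = inj₁ (Δ-depth-unreversed e unreversed)

    depth-label-potential : ∀ lab → IsLabelReorientation lab 𝒵 → IsLabelPotential lab depth
    depth-label-potential lab (onR , onF) =
      depth-small-dropping ,
      (λ e ℓ≡R → Δ-depth-reversed e (onR e ℓ≡R)) ,
      (λ e ℓ≡F → Δ-depth-unreversed e (onF e ℓ≡F))

  module _ (σ : Fin (n D) → ℕ)
           (small : ∀ e → σ (head D e) ≡ σ (tail D e) ⊎ σ (head D e) ≡ suc (σ (tail D e))) where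

    private
      tail≤head : ∀ e → σ (tail D e) ≤ σ (head D e)
      tail≤head e with small e
      ... | inj₁ flat = ℕₚ.≤-reflexive (sym flat)
      ... | inj₂ rise = ℕₚ.≤-trans (ℕₚ.n≤1+n _) (ℕₚ.≤-reflexive (sym rise))

      head≤1+tail : ∀ e → σ (head D e) ≤ suc (σ (tail D e))
      head≤1+tail e with small e
      ... | inj₁ flat = ℕₚ.≤-trans (ℕₚ.≤-reflexive flat) (ℕₚ.n≤1+n _)
      ... | inj₂ rise = ℕₚ.≤-reflexive rise

    height : ℕ
    height = ℕ-Extrema.max 0 (map σ (allFin (n D)))

    σ≤height : ∀ u → σ u ≤ height
    σ≤height u = All.lookup (ℕ-Extrema.xs≤max 0 (map σ (allFin (n D)))) (∈-map⁺ σ (∈-allFin u))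

    sublevel : Fin height → Subset (n D)
    sublevel i = tabulate (λ u → ⌊ σ u ≤? toℕ i ⌋)

    ∈-sublevel⇔ : ∀ {i u} → u ∈ₛ sublevel i ⇔ σ u ≤ toℕ i
    ∈-sublevel⇔ {i} {u} = ∈-tabulate⇔ (λ x → σ x ≤? toℕ i) u

    sublevel-dicut : ∀ i → NoArcEnters D (sublevel i)
    sublevel-dicut i e (h∈ , t∉) = t∉ (Equivalence.from ∈-sublevel⇔
      (ℕₚ.≤-trans (tail≤head e) (Equivalence.to ∈-sublevel⇔ h∈)))

    sublevel-cut : ∀ i e → InCut D (sublevel i) e →
      σ (tail D e) ≡ toℕ i × σ (head D e) ≡ suc (toℕ i)
    sublevel-cut i e (inj₂ entering)  = ⊥-elim (sublevel-dicut i e entering)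
    sublevel-cut i e (inj₁ (t∈ , h∉)) = tail≡i , head≡1+i
      where
      t≤i : σ (tail D e) ≤ toℕ i
      t≤i = Equivalence.to ∈-sublevel⇔ t∈
      i<h : toℕ i < σ (head D e)
      i<h = ℕₚ.≰⇒> (h∉ ∘ Equivalence.from ∈-sublevel⇔)
      tail≡i : σ (tail D e) ≡ toℕ i
      tail≡i = ℕₚ.≤-antisym t≤i (ℕₚ.≤-pred (ℕₚ.≤-trans i<h (head≤1+tail e)))
      head≡1+i : σ (head D e) ≡ suc (toℕ i)
      head≡1+i = ℕₚ.≤-antisym (ℕₚ.≤-trans (head≤1+tail e) (s≤s t≤i)) i<h

    sublevels : DisjointDicuts D
    sublevels = record
      { p        = height
      ; Z        = sublevel
      ; dicut    = sublevel-dicut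
      ; disjoint = λ i j e i≢j cutᵢ cutⱼ → i≢j (Fₚ.toℕ-injective
          (trans (sym (proj₁ (sublevel-cut i e cutᵢ))) (proj₁ (sublevel-cut j e cutⱼ))))
      }

    reversed⇔rise : ∀ e → Reversed D sublevels e ⇔ σ (head D e) ≡ suc (σ (tail D e))
    reversed⇔rise e = mk⇔ to from
      where
      to : Reversed D sublevels e → σ (head D e) ≡ suc (σ (tail D e))
      to (i , cut) with sublevel-cut i e cut
      ... | tail≡i , head≡1+i = trans head≡1+i (cong suc (sym tail≡i))

      from : σ (head D e) ≡ suc (σ (tail D e)) → Reversed D sublevels e
      from rise = i , inj₁ (Equivalence.from ∈-sublevel⇔ (ℕₚ.≤-reflexive (sym i≡tail)) , head∉)
        where
        tail<height : σ (tail D e) < height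
        tail<height = subst (_≤ height) rise (σ≤height (head D e))
        i : Fin height
        i = F.fromℕ< tail<height
        i≡tail : toℕ i ≡ σ (tail D e)
        i≡tail = Fₚ.toℕ-fromℕ< tail<height
        head∉ : head D e ∉ₛ sublevel i
        head∉ h∈ = ℕₚ.<-irrefl refl (ℕₚ.≤-trans (ℕₚ.≤-reflexive (sym rise))
          (ℕₚ.≤-trans (Equivalence.to ∈-sublevel⇔ h∈) (ℕₚ.≤-reflexive i≡tail)))

  label-potential⇒reorientation : ∀ lab π → IsLabelPotential lab π →
    ∃ λ 𝒵 → IsLabelReorientation lab 𝒵
  label-potential⇒reorientation lab π (small , onR , onF) with shift-to-ℕ π
  ... | σ , Δσ = sublevels σ smallσ , onR′ , onF′
    where
    Δ≡ : ∀ e → Δ D π e ≡ + σ (head D e) ℤ.- + σ (tail D e)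
    Δ≡ e = Δσ (head D e) (tail D e)
    smallσ : ∀ e → σ (head D e) ≡ σ (tail D e) ⊎ σ (head D e) ≡ suc (σ (tail D e))
    smallσ e = Sum.map (difference≡0 ∘ trans (sym (Δ≡ e)))
                       (difference≡1 ∘ trans (sym (Δ≡ e))) (small e)
    onR′ : ∀ e → lab e ≡ R → Reversed D (sublevels σ smallσ) e
    onR′ e ℓ≡R = Equivalence.from (reversed⇔rise σ smallσ e)
                   (difference≡1 (trans (sym (Δ≡ e)) (onR e ℓ≡R)))
    onF′ : ∀ e → lab e ≡ F → ¬ Reversed D (sublevels σ smallσ) e
    onF′ e ℓ≡F reversed = ℕₚ.1+n≢n (trans (sym (Equivalence.to (reversed⇔rise σ smallσ e) reversed))
                                        (difference≡0 (trans (sym (Δ≡ e)) (onF e ℓ≡F))))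

  circuitStep : (C : Circuit D) → Fin (k C) → Step
  circuitStep C i = a C i , forward D C i

  CircuitsNonnegative : (Step → ℤ) → Set
  CircuitsNonnegative w = ∀ (C : Circuit D) → 0ℤ ℤ.≤ ∑[ i < k C ] w (circuitStep C i)

  -- vertex and step are only meaningful up to the length; the bound in step is irrelevant,
  -- so steps taken at equal indices are definitionally equal.
  record Walk (l : ℕ) : Set where
    field
      vertex : ℕ → Fin (n D)
      step   : (t : ℕ) → .(t < l) → Step
      valid  : ∀ t (t<l : t < l) → src (step t t<l) ≡ vertex t × tgt (step t t<l) ≡ vertex (suc t)
  open Walk

  private variable
    l l′ : ℕ

  start end : Walk l → Fin (n D)
  start W = vertex W 0
  end {l} W = vertex W l

  Closed : Walk l → Set
  Closed W = end W ≡ start W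

  vertices : Walk l → Fin l → Fin (n D)
  vertices W i = vertex W (toℕ i)

  arcs : Walk l → Fin l → Fin (m D)
  arcs W i = proj₁ (step W (toℕ i) (Fₚ.toℕ<n i))

  weight : (Step → ℤ) → Walk l → ℤ
  weight {l} w W = ∑[ i < l ] w (step W (toℕ i) (Fₚ.toℕ<n i))

  stay : Fin (n D) → Walk 0
  stay u = record { vertex = const u ; step = λ _ () ; valid = λ _ () }

  prepend : (s : Step) (W : Walk l) → tgt s ≡ start W → Walk (suc l)
  prepend {l} s W joined = record { vertex = vertex′ ; step = step′ ; valid = valid′ }
    where
    vertex′ : ℕ → Fin (n D)
    vertex′ zero    = src s
    vertex′ (suc t) = vertex W t
    step′ : (t : ℕ) → .(t < suc l) → Step
    step′ zero    _   = s
    step′ (suc t) t<l = step W t (ℕₚ.≤-pred t<l)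
    valid′ : ∀ t (t<l : t < suc l) →
      src (step′ t t<l) ≡ vertex′ t × tgt (step′ t t<l) ≡ vertex′ (suc t)
    valid′ zero    _   = refl , joined
    valid′ (suc t) t<l = valid W t (ℕₚ.≤-pred t<l)

  behead : Walk (suc l) → Walk l
  behead W = record
    { vertex = vertex W ∘ suc
    ; step   = λ t t<l → step W (suc t) (s≤s t<l)
    ; valid  = λ t t<l → valid W (suc t) (s≤s t<l)
    }

  take : ∀ a {b} → Walk (a + b) → Walk a
  take a {b} W = record
    { vertex = vertex W
    ; step   = λ t t<a → step W t (ℕₚ.<-≤-trans t<a (ℕₚ.m≤m+n a b))
    ; valid  = λ t t<a → valid W t (ℕₚ.<-≤-trans t<a (ℕₚ.m≤m+n a b))
    }

  drop : ∀ a {b} → Walk (a + b) → Walk b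
  drop zero    W = W
  drop (suc a) W = drop a (behead W)

  vertex-drop : ∀ a {b} (W : Walk (a + b)) t → vertex (drop a W) t ≡ vertex W (a + t)
  vertex-drop zero    W t = refl
  vertex-drop (suc a) W t = vertex-drop a (behead W) t

  weight-take-drop : ∀ w a {b} (W : Walk (a + b)) →
    weight w (take a W) ℤ.+ weight w (drop a W) ≡ weight w W
  weight-take-drop w zero    W = ℤₚ.+-identityˡ (weight w W)
  weight-take-drop w (suc a) W = trans (ℤₚ.+-assoc (w (step W 0 (s≤s z≤n))) _ _)
    (cong (ℤ._+_ (w (step W 0 (s≤s z≤n)))) (weight-take-drop w a (behead W)))

  concat : (P : Walk l) (Q : Walk l′) → end P ≡ start Q → Walk (l + l′)
  start-concat : (P : Walk l) (Q : Walk l′) (joined : end P ≡ start Q) →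
    start (concat P Q joined) ≡ start P

  concat {zero}  P Q joined = Q
  concat {suc l} P Q joined = prepend (step P 0 (s≤s z≤n)) (concat (behead P) Q joined)
    (trans (proj₂ (valid P 0 (s≤s z≤n))) (sym (start-concat (behead P) Q joined)))

  start-concat {zero}  P Q joined = sym joined
  start-concat {suc l} P Q joined = proj₁ (valid P 0 (s≤s z≤n))

  end-concat : (P : Walk l) (Q : Walk l′) (joined : end P ≡ start Q) →
    end (concat P Q joined) ≡ end Q
  end-concat {zero}  P Q joined = refl
  end-concat {suc l} P Q joined = end-concat (behead P) Q joined

  weight-concat : ∀ w (P : Walk l) (Q : Walk l′) (joined : end P ≡ start Q) →
    weight w (concat P Q joined) ≡ weight w P ℤ.+ weight w Q
  weight-concat {zero}  w P Q joined = sym (ℤₚ.+-identityˡ (weight w Q))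
  weight-concat {suc l} w P Q joined = trans
    (cong (ℤ._+_ (w (step P 0 (s≤s z≤n)))) (weight-concat w (behead P) Q joined))
    (sym (ℤₚ.+-assoc (w (step P 0 (s≤s z≤n))) _ _))

  record Decomposition (W : Walk l) : Set where
    field
      outer-length inner-length : ℕ
      outer          : Walk outer-length
      inner          : Walk inner-length
      outer-shorter  : outer-length < l
      inner-shorter  : inner-length < l
      start-outer    : start outer ≡ start W
      end-outer      : end outer ≡ end W
      inner-closed   : Closed inner
      weight-split   : ∀ w → weight w outer ℤ.+ weight w inner ≡ weight w W

  open Decomposition

  cut-out : (W : Walk l) (i d r : ℕ) → i + (d + r) ≡ l → 0 < d → 0 < r →
    vertex W i ≡ vertex W (i + d) → Decomposition W
  cut-out W i d r refl 0<d 0<r repeat = record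
    { outer-length  = i + r
    ; inner-length  = d
    ; outer         = concat P Q joined
    ; inner         = C
    ; outer-shorter = ℕₚ.+-monoʳ-< i (ℕₚ.m<n+m r 0<d)
    ; inner-shorter = ℕₚ.<-≤-trans (ℕₚ.m<m+n d 0<r) (ℕₚ.m≤n+m (d + r) i)
    ; start-outer   = start-concat P Q joined
    ; end-outer     = trans (end-concat P Q joined)
                            (trans (vertex-drop d rest r) (vertex-drop i W (d + r)))
    ; inner-closed  = begin
        vertex rest d       ≡⟨ vertex-drop i W d ⟩
        vertex W (i + d)    ≡⟨ repeat ⟨
        vertex W i          ≡⟨ cong (vertex W) (ℕₚ.+-identityʳ i) ⟨
        vertex W (i + 0)    ≡⟨ vertex-drop i W 0 ⟨
        vertex rest 0       ∎
    ; weight-split  = λ w → begin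
        weight w (concat P Q joined) ℤ.+ weight w C
          ≡⟨ cong (λ x → x ℤ.+ weight w C) (weight-concat w P Q joined) ⟩
        (weight w P ℤ.+ weight w Q) ℤ.+ weight w C
          ≡⟨ swap-last (weight w P) (weight w Q) (weight w C) ⟩
        weight w P ℤ.+ (weight w C ℤ.+ weight w Q)
          ≡⟨ cong (ℤ._+_ (weight w P)) (weight-take-drop w d rest) ⟩
        weight w P ℤ.+ weight w rest
          ≡⟨ weight-take-drop w i W ⟩
        weight w W ∎
    }
    where
    open ≡-Reasoning
    P : Walk i
    P = take i W
    rest : Walk (d + r)
    rest = drop i W
    C : Walk d
    C = take d rest
    Q : Walk r
    Q = drop d rest
    joined : end P ≡ start Q
    joined = begin
      vertex W i            ≡⟨ repeat ⟩
      vertex W (i + d)      ≡⟨ cong (λ x → vertex W (i + x)) (ℕₚ.+-identityʳ d) ⟨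
      vertex W (i + (d + 0)) ≡⟨ vertex-drop i W (d + 0) ⟨
      vertex rest (d + 0)   ≡⟨ vertex-drop d rest 0 ⟨
      vertex Q 0            ∎
    swap-last : ∀ x y z → (x ℤ.+ y) ℤ.+ z ≡ x ℤ.+ (z ℤ.+ y)
    swap-last = solve-∀

  decompose : (W : Walk l) → Repeats (vertices W) → Decomposition W
  decompose {l} W (i , j , i<j , repeat) =
    cut-out W (toℕ i) (toℕ j ∸ toℕ i) (l ∸ toℕ j) length-split
      (ℕₚ.m<n⇒0<n∸m i<j) (ℕₚ.m<n⇒0<n∸m (Fₚ.toℕ<n j))
      (trans repeat (cong (vertex W) (sym i+d≡j)))
    where
    i+d≡j : toℕ i + (toℕ j ∸ toℕ i) ≡ toℕ j
    i+d≡j = ℕₚ.m+[n∸m]≡n (ℕₚ.<⇒≤ i<j)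
    length-split : toℕ i + ((toℕ j ∸ toℕ i) + (l ∸ toℕ j)) ≡ l
    length-split = trans (sym (ℕₚ.+-assoc (toℕ i) _ _))
      (trans (cong (_+ (l ∸ toℕ j)) i+d≡j) (ℕₚ.m+[n∸m]≡n (ℕₚ.<⇒≤ (Fₚ.toℕ<n j))))

  -- Shortest walks

  steps : List Step
  steps = cartesianProduct (allFin (m D)) (true ∷ false ∷ [])

  ∈-steps : ∀ s → s ∈ steps
  ∈-steps (e , true)  = ∈-cartesianProduct⁺ (∈-allFin e) (here refl)
  ∈-steps (e , false) = ∈-cartesianProduct⁺ (∈-allFin e) (there (here refl))

  module _ (w : Step → ℤ) (closed-nonneg : ∀ {l} (W : Walk l) → Closed W → 0ℤ ℤ.≤ weight w W) where

    offers : (Fin (n D) → ℤ) → Fin (n D) → List ℤ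
    offers δ u = map (λ s → w s ℤ.+ δ (tgt s)) (filter (λ s → src s F.≟ u) steps)

    relax : (Fin (n D) → ℤ) → Fin (n D) → ℤ
    relax δ u = ℤ-Extrema.min (δ u) (offers δ u)

    relax-≤ : ∀ δ u → relax δ u ℤ.≤ δ u
    relax-≤ δ u = ℤ-Extrema.min≤⊤ (δ u) (offers δ u)

    relax-≤-step : ∀ δ s → relax δ (src s) ℤ.≤ w s ℤ.+ δ (tgt s)
    relax-≤-step δ s = All.lookup (ℤ-Extrema.min≤xs (δ (src s)) (offers δ (src s)))
      (∈-map⁺ (λ s → w s ℤ.+ δ (tgt s)) (∈-filter⁺ (λ s′ → src s′ F.≟ src s) (∈-steps s) refl))

    relax-attained : ∀ δ u → relax δ u ≡ δ u ⊎ ∃ λ s → src s ≡ u × relax δ u ≡ w s ℤ.+ δ (tgt s)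
    relax-attained δ u with ℤ-Extrema.argmin-sel id (δ u) (offers δ u)
    ... | inj₁ unchanged = inj₁ unchanged
    ... | inj₂ offered with ∈-map⁻ (λ s → w s ℤ.+ δ (tgt s)) offered
    ...   | s , s∈ , improved =
      inj₂ (s , proj₂ (∈-filter⁻ (λ s′ → src s′ F.≟ u) {xs = steps} s∈) , improved)

    -- Bellman–Ford: distance t u is the least cost of a walk of length at most t from u.
    distance : ℕ → Fin (n D) → ℤ
    distance zero    _ = 0ℤ
    distance (suc t) = relax (distance t)

    distance-attained : ∀ t u →
      ∃₂ λ l (W : Walk l) → l ≤ t × start W ≡ u × weight w W ≡ distance t u
    distance-attained zero    u = 0 , stay u , z≤n , refl , refl
    distance-attained (suc t) u with relax-attained (distance t) u
    ... | inj₁ unchanged with distance-attained t u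
    ...   | l , W , l≤t , start≡ , weight≡ =
      l , W , ℕₚ.m≤n⇒m≤1+n l≤t , start≡ , trans weight≡ (sym unchanged)
    distance-attained (suc t) u | inj₂ (s , src≡ , improved) with distance-attained t (tgt s)
    ... | l , W , l≤t , start≡ , weight≡ =
      suc l , prepend s W (sym start≡) , s≤s l≤t , src≡ ,
      trans (cong (ℤ._+_ (w s)) weight≡) (sym improved)

    distance-≤-weight : ∀ t (W : Walk l) → l ≤ t → distance t (start W) ℤ.≤ weight w W
    distance-≤-weight {zero}  zero    W _ = ℤₚ.≤-refl
    distance-≤-weight {zero}  (suc t) W _ =
      ℤₚ.≤-trans (relax-≤ (distance t) (start W)) (distance-≤-weight t W z≤n)
    distance-≤-weight {suc l} (suc t) W (s≤s l≤t) = begin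
      relax (distance t) (start W)             ≡⟨ cong (relax (distance t)) src≡ ⟨
      relax (distance t) (src s)               ≤⟨ relax-≤-step (distance t) s ⟩
      w s ℤ.+ distance t (tgt s)               ≡⟨ cong (λ u → w s ℤ.+ distance t u) tgt≡ ⟩
      w s ℤ.+ distance t (start (behead W))
        ≤⟨ ℤₚ.+-monoʳ-≤ (w s) (distance-≤-weight t (behead W) l≤t) ⟩
      w s ℤ.+ weight w (behead W)              ∎
      where
      open ℤₚ.≤-Reasoning hiding (start)
      s : Step
      s = step W 0 (s≤s z≤n)
      src≡ : src s ≡ start W
      src≡ = proj₁ (valid W 0 (s≤s z≤n))
      tgt≡ : tgt s ≡ start (behead W)
      tgt≡ = proj₂ (valid W 0 (s≤s z≤n))

    weight-outer-≤ : {W : Walk l} (cut : Decomposition W) → weight w (outer cut) ℤ.≤ weight w W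
    weight-outer-≤ cut = subst (weight w (outer cut) ℤ.≤_) (weight-split cut w)
      (ℤₚ.i≤i+j _ _ {{ℤ.nonNegative (closed-nonneg (inner cut) (inner-closed cut))}})

    shorten : (W : Walk l) →
      ∃₂ λ l′ (W′ : Walk l′) → l′ ≤ n D × start W′ ≡ start W × weight w W′ ℤ.≤ weight w W
    shorten {l} = <-rec Shortenable shorten-below l
      where
      Shortenable : ℕ → Set
      Shortenable l = (W : Walk l) →
        ∃₂ λ l′ (W′ : Walk l′) → l′ ≤ n D × start W′ ≡ start W × weight w W′ ℤ.≤ weight w W
      shorten-below : ∀ l → (∀ {l′} → l′ < l → Shortenable l′) → Shortenable l
      shorten-below l rec W with l ≤? n D
      ... | yes l≤n = l , W , l≤n , refl , ℤₚ.≤-refl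
      ... | no l≰n = shorten-outer (decompose W (Fₚ.pigeonhole (ℕₚ.≰⇒> l≰n) (vertices W)))
        where
        shorten-outer : Decomposition W → _
        shorten-outer cut with rec (outer-shorter cut) (outer cut)
        ... | l′ , W′ , l′≤n , start≡ , weight≤ =
          l′ , W′ , l′≤n , trans start≡ (start-outer cut) , ℤₚ.≤-trans weight≤ (weight-outer-≤ cut)

    distance-stable : ∀ u → distance (n D) u ℤ.≤ distance (suc (n D)) u
    distance-stable u with distance-attained (suc (n D)) u
    ... | _ , W , _ , start≡ , weight≡ with shorten W
    ...   | _ , W′ , l′≤n , start′≡ , weight≤ = begin
      distance (n D) u            ≡⟨ cong (distance (n D)) (trans start′≡ start≡) ⟨
      distance (n D) (start W′)   ≤⟨ distance-≤-weight (n D) W′ l′≤n ⟩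
      weight w W′                 ≤⟨ weight≤ ⟩
      weight w W                  ≡⟨ weight≡ ⟩
      distance (suc (n D)) u      ∎
      where open ℤₚ.≤-Reasoning hiding (start)

    no-negative-closed-walk⇒feasible : ∃ (Feasible w)
    no-negative-closed-walk⇒feasible = ℤ.-_ ∘ distance (n D) , λ s →
      subst (ℤ._≤ w s) (sym (neg-minus-neg (distance (n D) (tgt s)) (distance (n D) (src s))))
        (i≤j+k⇒i-k≤j (ℤₚ.≤-trans (distance-stable (src s)) (relax-≤-step (distance (n D)) s)))

  -- Circuits and closed walks

  module _ (loopless : Loopless D) where

    tail≟src : ∀ e b {x} → src (e , b) ≡ x → ⌊ tail D e F.≟ x ⌋ ≡ b
    tail≟src e true  refl = ⌊⌋-true (tail D e F.≟ _) refl
    tail≟src e false refl = ⌊⌋-false (tail D e F.≟ _) (loopless e)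

    head≟src : ∀ e b {x} → src (e , b) ≡ x → ⌊ head D e F.≟ x ⌋ ≡ not b
    head≟src e true  refl = ⌊⌋-false (head D e F.≟ _) (loopless e ∘ sym)
    head≟src e false refl = ⌊⌋-true (head D e F.≟ _) refl

    private
      joining-step : ∀ (C : Circuit D) i → ∃ λ b →
        src (a C i , b) ≡ v C (inject₁ i) × tgt (a C i , b) ≡ v C (F.suc i)
      joining-step C i with joins C i
      ... | inj₁ ends = true , ends
      ... | inj₂ ends = false , ends

    circuitStep-joins : ∀ (C : Circuit D) i →
      src (circuitStep C i) ≡ v C (inject₁ i) × tgt (circuitStep C i) ≡ v C (F.suc i)
    circuitStep-joins C i with joining-step C i
    ... | b , ends =
      subst (λ b′ → src (a C i , b′) ≡ v C (inject₁ i) × tgt (a C i , b′) ≡ v C (F.suc i))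
            (sym (tail≟src (a C i) b (proj₁ ends))) ends

    backward≡not-forward : ∀ (C : Circuit D) i → backward D C i ≡ not (forward D C i)
    backward≡not-forward C i with joining-step C i
    ... | b , (src≡ , _) =
      trans (head≟src (a C i) b src≡) (cong not (sym (tail≟src (a C i) b src≡)))

    feasible⇒circuits-nonnegative : ∀ {w π} → Feasible w π → CircuitsNonnegative w
    feasible⇒circuits-nonnegative {w} {π} feasible C = begin
      0ℤ
        ≡⟨ sym (ℤₚ.i≡j⇒i-j≡0 (cong π (closed C))) ⟩
      π (v C (fromℕ (k C))) ℤ.- π (v C F.zero)
        ≡⟨ sym (∑-telescope (k C) (π ∘ v C)) ⟩
      ∑[ i < k C ] (π (v C (F.suc i)) ℤ.- π (v C (inject₁ i)))
        ≤⟨ ∑-mono-≤ rise≤cost ⟩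
      ∑[ i < k C ] w (circuitStep C i) ∎
      where
      open ℤₚ.≤-Reasoning
      rise≤cost : ∀ i → π (v C (F.suc i)) ℤ.- π (v C (inject₁ i)) ℤ.≤ w (circuitStep C i)
      rise≤cost i with circuitStep-joins C i
      ... | src≡ , tgt≡ =
        subst₂ (λ x y → π x ℤ.- π y ℤ.≤ w (circuitStep C i)) tgt≡ src≡ (feasible (circuitStep C i))

    module _ (lab : Fin (m D) → Part) where

      circuit-cost : ∀ (C : Circuit D) → ∑[ i < k C ] arcCost lab (circuitStep C i)
        ≡ + count (λ i → forward D C i ∧ isRN (lab (a C i)))
          ℤ.- + count (λ i → backward D C i ∧ isR (lab (a C i)))
      circuit-cost C = trans (sum-cong-≗ not-forward≡backward)
        (∑-indicator-difference (λ i → forward D C i ∧ isRN (lab (a C i)))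
                                (λ i → backward D C i ∧ isR (lab (a C i))))
        where
        not-forward≡backward : ∀ i → arcCost lab (circuitStep C i)
          ≡ indicator (forward D C i ∧ isRN (lab (a C i)))
            ℤ.- indicator (backward D C i ∧ isR (lab (a C i)))
        not-forward≡backward i =
          cong (λ b → indicator (forward D C i ∧ isRN (lab (a C i))) ℤ.- indicator (b ∧ isR (lab (a C i))))
               (sym (backward≡not-forward C i))

      circuit-reverse-cost : ∀ (C : Circuit D) → ∑[ i < k C ] arcCost lab (reverse (circuitStep C i))
        ≡ + count (λ i → backward D C i ∧ isRN (lab (a C i)))
          ℤ.- + count (λ i → forward D C i ∧ isR (lab (a C i)))
      circuit-reverse-cost C = trans (sum-cong-≗ reversed)
        (∑-indicator-difference (λ i → backward D C i ∧ isRN (lab (a C i)))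
                                (λ i → forward D C i ∧ isR (lab (a C i))))
        where
        reversed : ∀ i → arcCost lab (reverse (circuitStep C i))
          ≡ indicator (backward D C i ∧ isRN (lab (a C i)))
            ℤ.- indicator (forward D C i ∧ isR (lab (a C i)))
        reversed i =
          cong₂ (λ b b′ → indicator (b ∧ isRN (lab (a C i))) ℤ.- indicator (b′ ∧ isR (lab (a C i))))
                           (sym (backward≡not-forward C i)) (not-involutive (forward D C i))

      circuit-condition⇔ : CircuitCondition lab ⇔
        (CircuitsNonnegative (arcCost lab ∘ reverse) × CircuitsNonnegative (arcCost lab))
      circuit-condition⇔ = mk⇔
        (λ condition →
            (λ C → subst (0ℤ ℤ.≤_) (sym (circuit-reverse-cost C)) (≤⇒0≤-difference (proj₁ (condition C))))
          , (λ C → subst (0ℤ ℤ.≤_) (sym (circuit-cost C)) (≤⇒0≤-difference (proj₂ (condition C)))))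
        (λ (onReverse , onForward) C →
            0≤-difference⇒≤ (subst (0ℤ ℤ.≤_) (circuit-reverse-cost C) (onReverse C))
          , 0≤-difference⇒≤ (subst (0ℤ ℤ.≤_) (circuit-cost C) (onForward C)))

    loop-free : ∀ s → src s ≢ tgt s
    loop-free (e , true)  = loopless e
    loop-free (e , false) = loopless e ∘ sym

    module _ {l} (W : Walk l) (closed : Closed W) (simple : ¬ Repeats (vertices W)) where

      private
        src-at : ∀ i → src (step W (toℕ i) (Fₚ.toℕ<n i)) ≡ vertex W (toℕ (inject₁ i))
        src-at i = trans (proj₁ (valid W (toℕ i) (Fₚ.toℕ<n i)))
                         (cong (vertex W) (sym (Fₚ.toℕ-inject₁ i)))

      toCircuit : 2 ≤ l → Injective _≡_ _≡_ (arcs W) → Circuit D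
      toCircuit 2≤l arcs-injective = record
        { k      = l
        ; k≥2    = 2≤l
        ; v      = λ i → vertex W (toℕ i)
        ; closed = trans (cong (vertex W) (Fₚ.toℕ-fromℕ l)) closed
        ; v-inj  = λ {i} {j} same → ¬repeats⇒injective simple
            (subst₂ (λ x y → vertex W x ≡ vertex W y) (Fₚ.toℕ-inject₁ i) (Fₚ.toℕ-inject₁ j) same)
        ; a      = arcs W
        ; a-inj  = arcs-injective
        ; joins  = λ i → step-joins (step W (toℕ i) (Fₚ.toℕ<n i)) (src-at i)
                                     (proj₂ (valid W (toℕ i) (Fₚ.toℕ<n i)))
        }

      weight-toCircuit : (2≤l : 2 ≤ l) (arcs-injective : Injective _≡_ _≡_ (arcs W)) (w : Step → ℤ) →
        weight w W ≡ ∑[ i < l ] w (circuitStep (toCircuit 2≤l arcs-injective) i)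
      weight-toCircuit 2≤l arcs-injective w = sum-cong-≗ λ i →
        cong (λ b → w (arcs W i , b)) (sym (tail≟src (arcs W i) _ (src-at i)))

      distinct : ∀ {p q} → p < q → q < l → vertex W p ≢ vertex W q
      distinct {p} {q} p<q q<l same = simple (F.fromℕ< p<l , F.fromℕ< q<l , ordered , repeated)
        where
        p<l : p < l
        p<l = ℕₚ.<-trans p<q q<l
        ordered : F.fromℕ< p<l F.< F.fromℕ< q<l
        ordered = subst₂ _<_ (sym (Fₚ.toℕ-fromℕ< p<l)) (sym (Fₚ.toℕ-fromℕ< q<l)) p<q
        repeated : vertex W (toℕ (F.fromℕ< p<l)) ≡ vertex W (toℕ (F.fromℕ< q<l))
        repeated = subst₂ (λ x y → vertex W x ≡ vertex W y)
          (sym (Fₚ.toℕ-fromℕ< p<l)) (sym (Fₚ.toℕ-fromℕ< q<l)) same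

      no-reversed-repeat : 3 ≤ l → ∀ {p q} → p < q → q < l →
        vertex W q ≡ vertex W (suc p) → vertex W (suc q) ≡ vertex W p → ⊥
      no-reversed-repeat 3≤l {p} {q} p<q q<l q~p+1 q+1~p with ℕₚ.m≤n⇒m<n∨m≡n p<q
      ... | inj₁ p+1<q = distinct p+1<q q<l (sym q~p+1)
      ... | inj₂ refl with ℕₚ.m≤n⇒m<n∨m≡n q<l
      ...   | inj₁ q+1<l = distinct (ℕₚ.<-trans (ℕₚ.n<1+n p) (ℕₚ.n<1+n (suc p))) q+1<l (sym q+1~p)
      ...   | inj₂ refl =
        distinct (ℕₚ.≤-pred (ℕₚ.≤-pred 3≤l)) (ℕₚ.<-trans p<q q<l) (trans (sym closed) q+1~p)

      no-repeated-arc : 3 ≤ l → ∀ {p q} (p<l : p < l) (q<l : q < l) → p < q →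
        proj₁ (step W p p<l) ≢ proj₁ (step W q q<l)
      no-repeated-arc 3≤l {p} {q} p<l q<l p<q same with same-arc (step W p p<l) (step W q q<l) same
      ... | inj₁ s′≡s = distinct p<q q<l (begin
        vertex W p            ≡⟨ proj₁ (valid W p p<l) ⟨
        src (step W p p<l)    ≡⟨ cong src s′≡s ⟨
        src (step W q q<l)    ≡⟨ proj₁ (valid W q q<l) ⟩
        vertex W q            ∎)
        where open ≡-Reasoning
      ... | inj₂ s′≡s⁻¹ = no-reversed-repeat 3≤l p<q q<l
        (trans (sym (proj₁ (valid W q q<l))) (trans (cong src s′≡s⁻¹) (proj₂ (valid W p p<l))))
        (trans (sym (proj₂ (valid W q q<l)))
          (trans (cong tgt s′≡s⁻¹) (trans (tgt-reverse (step W p p<l)) (proj₁ (valid W p p<l)))))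

      arcs-injective : 3 ≤ l → Injective _≡_ _≡_ (arcs W)
      arcs-injective 3≤l {i} {j} same with Fₚ.<-cmp i j
      ... | tri< i<j _ _ = ⊥-elim (no-repeated-arc 3≤l (Fₚ.toℕ<n i) (Fₚ.toℕ<n j) i<j same)
      ... | tri≈ _ i≡j _ = i≡j
      ... | tri> _ _ j<i = ⊥-elim (no-repeated-arc 3≤l (Fₚ.toℕ<n j) (Fₚ.toℕ<n i) j<i (sym same))

    module _ (w : Step → ℤ) (backtrack-nonneg : ∀ s → 0ℤ ℤ.≤ w s ℤ.+ w (reverse s))
             (circuits-nonneg : CircuitsNonnegative w) where

      private
        via-circuit : (W : Walk l) (closed : Closed W) (simple : ¬ Repeats (vertices W)) →
          2 ≤ l → Injective _≡_ _≡_ (arcs W) → 0ℤ ℤ.≤ weight w W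
        via-circuit W closed simple 2≤l arcs-injective =
          subst (0ℤ ℤ.≤_) (sym (weight-toCircuit W closed simple 2≤l arcs-injective w))
            (circuits-nonneg (toCircuit W closed simple 2≤l arcs-injective))

      simple-closed-walk-nonneg : (W : Walk l) → Closed W → ¬ Repeats (vertices W) →
        0ℤ ℤ.≤ weight w W
      simple-closed-walk-nonneg {zero} W closed simple = ℤₚ.≤-refl
      simple-closed-walk-nonneg {suc zero} W closed simple =
        ⊥-elim (loop-free s (trans (proj₁ (valid W 0 (s≤s z≤n)))
                                   (sym (trans (proj₂ (valid W 0 (s≤s z≤n))) closed))))
        where
        s : Step
        s = step W 0 (s≤s z≤n)
      simple-closed-walk-nonneg {suc (suc zero)} W closed simple
        with arcs W F.zero F.≟ arcs W (F.suc F.zero)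
      ... | no different = via-circuit W closed simple ℕₚ.≤-refl (injective₂ different)
      ... | yes same =
        subst (0ℤ ℤ.≤_) (trans (cong (ℤ._+_ (w s₀)) (cong w (sym s₁≡s₀⁻¹)))
                               (cong (ℤ._+_ (w s₀)) (sym (ℤₚ.+-identityʳ (w s₁)))))
          (backtrack-nonneg s₀)
        where
        s₀ s₁ : Step
        s₀ = step W 0 (s≤s z≤n)
        s₁ = step W 1 (s≤s (s≤s z≤n))
        s₁≡s₀⁻¹ : s₁ ≡ reverse s₀
        s₁≡s₀⁻¹ with same-arc s₀ s₁ same
        ... | inj₂ reversed = reversed
        ... | inj₁ s₁≡s₀ = ⊥-elim (loop-free s₀ (trans (cong src (sym s₁≡s₀))
          (trans (proj₁ (valid W 1 (s≤s (s≤s z≤n)))) (sym (proj₂ (valid W 0 (s≤s z≤n)))))))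
      simple-closed-walk-nonneg {suc (suc (suc l))} W closed simple =
        via-circuit W closed simple (s≤s (s≤s z≤n))
          (arcs-injective W closed simple (s≤s (s≤s (s≤s z≤n))))

      closed-walk-nonneg : (W : Walk l) → Closed W → 0ℤ ℤ.≤ weight w W
      closed-walk-nonneg {l} = <-rec ClosedNonneg nonneg-below l
        where
        ClosedNonneg : ℕ → Set
        ClosedNonneg l = (W : Walk l) → Closed W → 0ℤ ℤ.≤ weight w W

        nonneg-below : ∀ l → (∀ {l′} → l′ < l → ClosedNonneg l′) → ClosedNonneg l
        nonneg-below l rec W closed with repeats? F._≟_ (vertices W)
        ... | no simple  = simple-closed-walk-nonneg W closed simple
        ... | yes repeat = split-nonneg (decompose W repeat)
          where
          split-nonneg : Decomposition W → 0ℤ ℤ.≤ weight w W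
          split-nonneg cut = subst (0ℤ ℤ.≤_) (weight-split cut w) (ℤₚ.+-mono-≤
            (rec (outer-shorter cut) (outer cut)
                 (trans (end-outer cut) (trans closed (sym (start-outer cut)))))
            (rec (inner-shorter cut) (inner cut) (inner-closed cut)))

    label-potential⇒circuit-condition : ∀ lab π → IsLabelPotential lab π → CircuitCondition lab
    label-potential⇒circuit-condition lab π potential = Equivalence.from (circuit-condition⇔ lab)
      ( feasible⇒circuits-nonnegative {π = ℤ.-_ ∘ π} (feasible-reverse {π = π} feasible)
      , feasible⇒circuits-nonnegative {π = π} feasible )
      where
      feasible : Feasible (arcCost lab) π
      feasible = Equivalence.to (label-potential⇔feasible lab π) potential

    circuit-condition⇒label-potential : ∀ lab → CircuitCondition lab → ∃ (IsLabelPotential lab)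
    circuit-condition⇒label-potential lab condition =
      Product.map₂ (λ {π} → Equivalence.from (label-potential⇔feasible lab π))
        (no-negative-closed-walk⇒feasible (arcCost lab)
          (closed-walk-nonneg (arcCost lab) (λ (e , b) → cost-backtrack (lab e) b)
            (proj₂ (Equivalence.to (circuit-condition⇔ lab) condition))))

claim3p2 : (D : Digraph) → Loopless D → WeaklyConnected D → 2 ≤ n D →
  (lab : Fin (m D) → Part) →
  ((∃ λ (𝒵 : DisjointDicuts D) →
       (∀ e → lab e ≡ R → Reversed D 𝒵 e) × (∀ e → lab e ≡ F → ¬ Reversed D 𝒵 e))
    ⇔ (∃ λ (π : Fin (n D) → ℤ) → SmallDropping D π ×
         (∀ e → lab e ≡ R → Δ D π e ≡ 1ℤ) × (∀ e → lab e ≡ F → Δ D π e ≡ 0ℤ)))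
  × ((∃ λ (π : Fin (n D) → ℤ) → SmallDropping D π ×
         (∀ e → lab e ≡ R → Δ D π e ≡ 1ℤ) × (∀ e → lab e ≡ F → Δ D π e ≡ 0ℤ))
    ⇔ (∀ (C : Circuit D) →
         (count (λ i → forward D C i ∧ isR (lab (a C i)))
            ≤ count (λ i → backward D C i ∧ isRN (lab (a C i))))
       × (count (λ i → backward D C i ∧ isR (lab (a C i)))
            ≤ count (λ i → forward D C i ∧ isRN (lab (a C i))))))
claim3p2 D loopless _ _ lab =
    mk⇔ (λ (𝒵 , reorientation) → depth D 𝒵 , depth-label-potential D 𝒵 lab reorientation)
        (λ (π , potential) → label-potential⇒reorientation D lab π potential)
  , mk⇔ (λ (π , potential) → label-potential⇒circuit-condition D loopless lab π potential)
        (circuit-condition⇒label-potential D loopless lab)
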